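{- Every (finite, nonempty) binary tree is the underlying binary tree of exactly one rectangular Baxter tree-like tableau, that is, a tree-like tableau whose Ferrers diagram is a rectangle and which contains neither of the patterns H and V.
   Context: A binary tree here is a finite rooted tree in which each vertex has at most one left child and at most one right child. Ferrers diagrams are drawn in English notation. A tree-like tableau (TLT) is a nonempty Ferrers diagram each of whose cells is empty or pointed, such that: (1) the top-left cell is pointed (the root); (2) every non-root pointed cell $c$ has a pointed cell above it in its column or to its left in its row, but not both; the nearest such pointed cell is its parent; (3) every row and column contains a pointed cell. The underlying binary tree has the points as vertices, rooted at the root point; a point whose parent lies above it is the left child of its parent, and one whose parent lies to its left is the right child. A TLT contains pattern H if there are rows $r_1$ above $r_2$ and columns $c_1<c_2<c_3$ with all six cells $(r_a,c_b)$ in the diagram such that $(r_1,c_2),(r_2,c_1),(r_2,c_3)$ are pointed and $(r_1,c_3),(r_2,c_2)$ empty; pattern V if there are rows $r_1$ above $r_2$ above $r_3$ and columns $c_1<c_2$ with all six cells in the diagram such that $(r_1,c_2),(r_2,c_1),(r_3,c_2)$ are pointed and $(r_2,c_2),(r_3,c_1)$ empty. -}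

module Defs where

open import Data.Nat using (ℕ; suc)
open import Data.Bool using (Bool; true; false)
open import Data.Fin using (Fin; zero; _<_)
open import Data.Vec using (Vec; lookup)
open import Data.Product using (Σ; _×_; ∃; ∃-syntax; _,_)
open import Data.Sum using (_⊎_)
open import Relation.Nullary using (¬_)
open import Relation.Binary.PropositionalEquality using (_≡_)

-- Binary trees; `leaf` is the empty tree, a vertex is `node left right`.
data BT : Set where
  leaf : BT
  node : BT → BT → BT

-- Row index 0 is the top row (English notation),
-- column index 0 the leftmost column.
record RectTableau : Set where
  constructor mkTab
  field
    m n   : ℕ
    cells : Vec (Vec Bool (suc n)) (suc m)

open RectTableau public

module _ (t : RectTableau) where

  Row = Fin (suc (m t))
  Col = Fin (suc (n t))

  Pointed : Row → Col → Set
  Pointed i j = lookup (lookup (cells t) i) j ≡ true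

  Empty : Row → Col → Set
  Empty i j = lookup (lookup (cells t) i) j ≡ false

  PointAbove : Row → Col → Set
  PointAbove i j = ∃[ k ] (k < i × Pointed k j)

  PointLeft : Row → Col → Set
  PointLeft i j = ∃[ k ] (k < j × Pointed i k)

  IsTLT : Set
  IsTLT =
      Pointed zero zero
    × (∀ i j → Pointed i j → ¬ (i ≡ zero × j ≡ zero) →
         (PointAbove i j × ¬ PointLeft i j) ⊎ (¬ PointAbove i j × PointLeft i j))
    × (∀ i → ∃[ j ] Pointed i j)
    × (∀ j → ∃[ i ] Pointed i j)

  ContainsH : Set
  ContainsH = ∃[ r₁ ] ∃[ r₂ ] ∃[ c₁ ] ∃[ c₂ ] ∃[ c₃ ]
    ( r₁ < r₂ × c₁ < c₂ × c₂ < c₃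
    × Pointed r₁ c₂ × Pointed r₂ c₁ × Pointed r₂ c₃
    × Empty r₁ c₃ × Empty r₂ c₂ )

  ContainsV : Set
  ContainsV = ∃[ r₁ ] ∃[ r₂ ] ∃[ r₃ ] ∃[ c₁ ] ∃[ c₂ ]
    ( r₁ < r₂ × r₂ < r₃ × c₁ < c₂
    × Pointed r₁ c₂ × Pointed r₂ c₁ × Pointed r₃ c₂
    × Empty r₂ c₂ × Empty r₃ c₁ )

  -- rectangular Baxter tree-like tableau (rectangularity is built into RectTableau)
  IsRectBaxterTLT : Set
  IsRectBaxterTLT = IsTLT × ¬ ContainsH × ¬ ContainsV

  LeftChild : Row → Col → Row → Set
  LeftChild i j i' =
      Pointed i j × Pointed i' j × i < i'
    × (∀ k → i < k → k < i' → ¬ Pointed k j)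
    × ¬ PointLeft i' j

  RightChild : Row → Col → Col → Set
  RightChild i j j' =
      Pointed i j × Pointed i j' × j < j'
    × (∀ k → j < k → k < j' → ¬ Pointed i k)
    × ¬ PointAbove i j'

  -- Sub i j T : the subtree (of the underlying binary tree) rooted at the
  -- point (i , j) is T.
  data Sub (i : Row) (j : Col) : BT → Set
  data LeftSub (i : Row) (j : Col) : BT → Set
  data RightSub (i : Row) (j : Col) : BT → Set

  data Sub i j where
    vertex : ∀ {L R} → Pointed i j → LeftSub i j L → RightSub i j R → Sub i j (node L R)

  data LeftSub i j where
    noLeft  : (∀ i' → ¬ LeftChild i j i') → LeftSub i j leaf
    hasLeft : ∀ {L} i' → LeftChild i j i' → Sub i' j L → LeftSub i j L

  data RightSub i j where
    noRight  : (∀ j' → ¬ RightChild i j j') → RightSub i j leaf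
    hasRight : ∀ {R} j' → RightChild i j j' → Sub i j' R → RightSub i j R

  UnderlyingTree : BT → Set
  UnderlyingTree T = Sub zero zero T

{-# OPTIONS --safe #-}
-- Build the canonical tableau of T = node L R recursively: the root sits alone in a top-left block
-- of height⁺ R × width⁺ L cells, the tableau of R lies to its right, that of L below it, and the
-- bottom-right block is empty; it is a rectangular Baxter TLT with underlying tree T.
-- Conversely, in a Baxter TLT the parent chain of a point in the quadrant below-right of a vertex v
-- cannot leave that quadrant without creating an H or a V, so it returns to v through a child of v.
-- Hence the left and right subtrees of v occupy quadrants that cannot overlap, which pins the left
-- child exactly height⁺ R rows below v and the right child width⁺ L columns to its right; by
-- induction on the tree, the tableau coincides with the canonical one.
module Submission where

open import Defs
open import Data.Bool using (Bool; true; false)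
open import Data.Bool.Properties using (¬-not; not-¬)
open import Data.Empty using (⊥)
open import Data.Fin using (toℕ; fromℕ<) renaming (zero to fzero)
open import Data.Fin.Properties using (toℕ-fromℕ<; fromℕ<-toℕ; toℕ-injective; toℕ<n)
open import Data.Nat using (ℕ; zero; suc; pred; _+_; _∸_; _≤_; _<_; z≤n; s≤s; s≤s⁻¹; _<?_; _≤?_; _≟_)
open import Data.Nat.Properties
open import Data.Product using (Σ; ∃!; ∃-syntax; _×_; _,_; proj₁; proj₂)
open import Data.Sum using (_⊎_; inj₁; inj₂; [_,_]′)
open import Data.Unit using (⊤; tt)
open import Data.Vec using (Vec; lookup; tabulate)
open import Data.Vec.Properties using (lookup∘tabulate; tabulate∘lookup; tabulate-cong)
open import Relation.Binary.Definitions using (tri<; tri≈; tri>)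
open import Relation.Binary.PropositionalEquality using (_≡_; _≢_; refl; sym; trans; cong; subst; subst₂; cong₂)
open import Relation.Nullary using (¬_; yes; no; contradiction)
open import Relation.Nullary.Decidable using (_×-dec_)

Grid : Set
Grid = ℕ → ℕ → Bool

module GridNotions (g : Grid) where

  Pt : ℕ → ℕ → Set
  Pt r c = g r c ≡ true

  PtAbove : ℕ → ℕ → Set
  PtAbove r c = ∃[ k ] (k < r × Pt k c)

  PtLeft : ℕ → ℕ → Set
  PtLeft r c = ∃[ k ] (k < c × Pt r k)

  ParentCondition : ℕ → ℕ → Set
  ParentCondition r c = (PtAbove r c × ¬ PtLeft r c) ⊎ (¬ PtAbove r c × PtLeft r c)

  record LeftC (i j i′ : ℕ) : Set where
    constructor leftC
    field
      parent   : Pt i j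
      child    : Pt i′ j
      below    : i < i′
      gap      : ∀ k → i < k → k < i′ → ¬ Pt k j
      leftmost : ∀ k → k < j → ¬ Pt i′ k

  record RightC (i j j′ : ℕ) : Set where
    constructor rightC
    field
      parent  : Pt i j
      child   : Pt i j′
      right   : j < j′
      gap     : ∀ k → j < k → k < j′ → ¬ Pt i k
      topmost : ∀ k → k < i → ¬ Pt k j′

  data GSub (i j : ℕ) : BT → Set
  data GLeftSub (i j : ℕ) : BT → Set
  data GRightSub (i j : ℕ) : BT → Set

  data GSub i j where
    gv : ∀ {L R} → Pt i j → GLeftSub i j L → GRightSub i j R → GSub i j (node L R)

  data GLeftSub i j where
    noL  : (∀ i′ → ¬ LeftC i j i′) → GLeftSub i j leaf
    hasL : ∀ {L} i′ → LeftC i j i′ → GSub i′ j L → GLeftSub i j L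

  data GRightSub i j where
    noR  : (∀ j′ → ¬ RightC i j j′) → GRightSub i j leaf
    hasR : ∀ {R} j′ → RightC i j j′ → GSub i j′ R → GRightSub i j R

  data HPattern : Set where
    hPattern : ∀ r₁ r₂ c₁ c₂ c₃ → r₁ < r₂ → c₁ < c₂ → c₂ < c₃ →
               Pt r₁ c₂ → Pt r₂ c₁ → Pt r₂ c₃ → g r₁ c₃ ≡ false → g r₂ c₂ ≡ false → HPattern

  data VPattern : Set where
    vPattern : ∀ r₁ r₂ r₃ c₁ c₂ → r₁ < r₂ → r₂ < r₃ → c₁ < c₂ →
               Pt r₁ c₂ → Pt r₂ c₁ → Pt r₃ c₂ → g r₂ c₂ ≡ false → g r₃ c₁ ≡ false → VPattern

  record IsBaxterGrid (H W : ℕ) : Set where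
    field
      bounded    : ∀ r c → Pt r c → r < H × c < W
      parentCond : ∀ r c → Pt r c → ¬ (r ≡ 0 × c ≡ 0) → ParentCondition r c
      rowPointed : ∀ r → r < H → ∃[ c ] Pt r c
      colPointed : ∀ c → c < W → ∃[ r ] Pt r c
      noH        : ¬ HPattern
      noV        : ¬ VPattern

isOrigin : ℕ → ℕ → Bool
isOrigin zero    zero    = true
isOrigin zero    (suc _) = false
isOrigin (suc _) _       = false

isOrigin-true : ∀ r c → isOrigin r c ≡ true → r ≡ 0 × c ≡ 0
isOrigin-true zero    zero    _  = refl , refl
isOrigin-true zero    (suc c) ()
isOrigin-true (suc r) c       ()

isOrigin-false : ∀ r c → ¬ (r ≡ 0 × c ≡ 0) → isOrigin r c ≡ false
isOrigin-false zero    zero    ¬o = contradiction (refl , refl) ¬o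
isOrigin-false zero    (suc c) _  = refl
isOrigin-false (suc r) c       _  = refl

originOr : ∀ {P : Set} r c → (¬ (r ≡ 0 × c ≡ 0) → P) → (r ≡ 0 × c ≡ 0) ⊎ P
originOr r c f with (r ≟ 0) ×-dec (c ≟ 0)
... | yes o  = inj₁ o
... | no ¬o = inj₂ (f ¬o)

-- height⁺ and width⁺ agree with height and width except on the empty tree, where they
-- are 1: the root of node L R occupies a block of height⁺ R rows and width⁺ L columns.
height height⁺ width width⁺ : BT → ℕ
height leaf       = 0
height (node L R) = height L + height⁺ R
height⁺ leaf       = 1
height⁺ (node L R) = height L + height⁺ R
width leaf       = 0
width (node L R) = width⁺ L + width R
width⁺ leaf       = 1
width⁺ (node L R) = width⁺ L + width R

height⁺-pos : ∀ T → 1 ≤ height⁺ T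
height⁺-pos leaf       = s≤s z≤n
height⁺-pos (node L R) = ≤-trans (height⁺-pos R) (m≤n+m (height⁺ R) (height L))

width⁺-pos : ∀ T → 1 ≤ width⁺ T
width⁺-pos leaf       = s≤s z≤n
width⁺-pos (node L R) = ≤-trans (width⁺-pos L) (m≤m+n (width⁺ L) (width R))

height≤height⁺ : ∀ T → height T ≤ height⁺ T
height≤height⁺ leaf       = z≤n
height≤height⁺ (node L R) = ≤-refl

width≤width⁺ : ∀ T → width T ≤ width⁺ T
width≤width⁺ leaf       = z≤n
width≤width⁺ (node L R) = ≤-refl

data Band (x : ℕ) : ℕ → Set where
  inside : ∀ {r} → r < x → Band x r
  beyond : ∀ r → Band x (x + r)

band : ∀ x r → Band x r
band x r with r <? x
... | yes r<x = inside r<x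
... | no r≮x with m≤n⇒∃[o]m+o≡n (≮⇒≥ r≮x)
...   | r′ , refl = beyond r′

data Quadrant (x y : ℕ) : ℕ → ℕ → Set where
  TL : ∀ {r c} → r < x → c < y → Quadrant x y r c
  TR : ∀ {r} c → r < x → Quadrant x y r (y + c)
  BL : ∀ r {c} → c < y → Quadrant x y (x + r) c
  BR : ∀ r c → Quadrant x y (x + r) (y + c)

quadrant : ∀ x y r c → Quadrant x y r c
quadrant x y r c with band x r | band y c
... | inside r<x | inside c<y = TL r<x c<y
... | inside r<x | beyond c′  = TR c′ r<x
... | beyond r′  | inside c<y = BL r′ c<y
... | beyond r′  | beyond c′  = BR r′ c′

blockGrid : ℕ → ℕ → Grid → Grid → Grid
blockGrid x y gL gR r c with r <? x | c <? y
... | yes _ | yes _ = isOrigin r c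
... | yes _ | no _  = gR r (c ∸ y)
... | no _  | yes _ = gL (r ∸ x) c
... | no _  | no _  = false

module _ (x y : ℕ) (gL gR : Grid) where

  blockGrid-TL : ∀ {r c} → r < x → c < y → blockGrid x y gL gR r c ≡ isOrigin r c
  blockGrid-TL {r} {c} r<x c<y with r <? x | c <? y
  ... | yes _   | yes _   = refl
  ... | no r≮x  | _       = contradiction r<x r≮x
  ... | yes _   | no c≮y  = contradiction c<y c≮y

  blockGrid-TR : ∀ {r} c → r < x → blockGrid x y gL gR r (y + c) ≡ gR r c
  blockGrid-TR {r} c r<x with r <? x | y + c <? y
  ... | yes _  | no _   = cong (gR r) (m+n∸m≡n y c)
  ... | no r≮x | _      = contradiction r<x r≮x
  ... | yes _  | yes lt = contradiction lt (m+n≮m y c)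

  blockGrid-BL : ∀ r {c} → c < y → blockGrid x y gL gR (x + r) c ≡ gL r c
  blockGrid-BL r {c} c<y with x + r <? x | c <? y
  ... | no _    | yes _  = cong (λ z → gL z c) (m+n∸m≡n x r)
  ... | yes lt  | _      = contradiction lt (m+n≮m x r)
  ... | no _    | no c≮y = contradiction c<y c≮y

  blockGrid-BR : ∀ r c → blockGrid x y gL gR (x + r) (y + c) ≡ false
  blockGrid-BR r c with x + r <? x | y + c <? y
  ... | no _   | no _   = refl
  ... | yes lt | _      = contradiction lt (m+n≮m x r)
  ... | no _   | yes lt = contradiction lt (m+n≮m y c)

canon : BT → Grid
canon leaf       = λ _ _ → false
canon (node L R) = blockGrid (height⁺ R) (width⁺ L) (canon L) (canon R)

module _ (L R : BT) where

  canon-TL : ∀ {r c} → r < height⁺ R → c < width⁺ L → canon (node L R) r c ≡ isOrigin r c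
  canon-TL = blockGrid-TL (height⁺ R) (width⁺ L) (canon L) (canon R)

  canon-TR : ∀ {r} c → r < height⁺ R → canon (node L R) r (width⁺ L + c) ≡ canon R r c
  canon-TR = blockGrid-TR (height⁺ R) (width⁺ L) (canon L) (canon R)

  canon-BL : ∀ r {c} → c < width⁺ L → canon (node L R) (height⁺ R + r) c ≡ canon L r c
  canon-BL = blockGrid-BL (height⁺ R) (width⁺ L) (canon L) (canon R)

  canon-BR : ∀ r c → canon (node L R) (height⁺ R + r) (width⁺ L + c) ≡ false
  canon-BR = blockGrid-BR (height⁺ R) (width⁺ L) (canon L) (canon R)

  canon-origin : canon (node L R) 0 0 ≡ true
  canon-origin = canon-TL (height⁺-pos R) (width⁺-pos L)

  canon-TL-origin : ∀ {r c} → r < height⁺ R → c < width⁺ L → canon (node L R) r c ≡ true → r ≡ 0 × c ≡ 0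
  canon-TL-origin {r} {c} r<x c<y pt = isOrigin-true r c (trans (sym (canon-TL r<x c<y)) pt)

canon-bounded : ∀ T r c → canon T r c ≡ true → r < height T × c < width T
canon-bounded (node L R) r c pt with quadrant (height⁺ R) (width⁺ L) r c
... | TL r<x c<y =
  <-≤-trans r<x (m≤n+m _ (height L)) , <-≤-trans c<y (m≤m+n _ (width R))
... | TR c′ r<x =
  <-≤-trans r<x (m≤n+m _ (height L)) ,
  +-monoʳ-< (width⁺ L) (proj₂ (canon-bounded R r c′ (trans (sym (canon-TR L R c′ r<x)) pt)))
... | BL r′ c<y =
  subst (height⁺ R + r′ <_) (+-comm (height⁺ R) (height L))
    (+-monoʳ-< (height⁺ R) (proj₁ (canon-bounded L r′ c (trans (sym (canon-BL L R r′ c<y)) pt)))) ,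
  <-≤-trans c<y (m≤m+n _ (width R))
... | BR r′ c′ = contradiction (trans (sym pt) (canon-BR L R r′ c′)) λ ()

canon-rowPointed : ∀ T r → r < height T → ∃[ c ] canon T r c ≡ true
canon-rowPointed (node L R) r r<h with band (height⁺ R) r
canon-rowPointed (node L leaf) zero _ | inside _ = 0 , canon-origin L leaf
canon-rowPointed (node L leaf) (suc r) _ | inside (s≤s ())
canon-rowPointed (node L R@(node _ _)) r _ | inside r<x =
  let c , pt = canon-rowPointed R r r<x in width⁺ L + c , trans (canon-TR L R c r<x) pt
canon-rowPointed (node leaf R) _ r<h | beyond r′ = contradiction r<h (m+n≮m (height⁺ R) r′)
canon-rowPointed (node L@(node _ _) R) _ r<h | beyond r′ =
  let r′<h = +-cancelˡ-< (height⁺ R) r′ (height L) (subst (height⁺ R + r′ <_) (+-comm (height L) (height⁺ R)) r<h)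
      c , pt = canon-rowPointed L r′ r′<h
  in c , trans (canon-BL L R r′ (proj₂ (canon-bounded L r′ c pt))) pt

canon-colPointed : ∀ T c → c < width T → ∃[ r ] canon T r c ≡ true
canon-colPointed (node L R) c c<w with band (width⁺ L) c
canon-colPointed (node leaf R) zero _ | inside _ = 0 , canon-origin leaf R
canon-colPointed (node leaf R) (suc c) _ | inside (s≤s ())
canon-colPointed (node L@(node _ _) R) c _ | inside c<y =
  let r , pt = canon-colPointed L c c<y in height⁺ R + r , trans (canon-BL L R r c<y) pt
canon-colPointed (node L leaf) _ c<w | beyond c′ =
  contradiction (subst (width⁺ L + c′ <_) (+-identityʳ (width⁺ L)) c<w) (m+n≮m (width⁺ L) c′)
canon-colPointed (node L R@(node _ _)) _ c<w | beyond c′ =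
  let r , pt = canon-colPointed R c′ (+-cancelˡ-< (width⁺ L) c′ (width R) c<w)
  in r , trans (canon-TR L R c′ (proj₁ (canon-bounded R r c′ pt))) pt

module _ (L R : BT) where
  private
    module Whole = GridNotions (canon (node L R))
    module Left  = GridNotions (canon L)
    module Right = GridNotions (canon R)

  parentCondition-TR : ∀ {r c} → r < height⁺ R → (r ≡ 0 × c ≡ 0) ⊎ Right.ParentCondition r c →
                       Whole.ParentCondition r (width⁺ L + c)
  parentCondition-TR r<x (inj₁ (refl , refl)) =
    inj₂ ((λ { (_ , () , _) }) , (0 , ≤-trans (width⁺-pos L) (m≤m+n (width⁺ L) 0) , canon-origin L R))
  parentCondition-TR {r} {c} r<x (inj₂ (inj₁ ((k , k<r , pk) , ¬left))) =
    inj₁ ((k , k<r , trans (canon-TR L R c (<-trans k<r r<x)) pk) , ¬left′)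
    where
    ¬left′ : ¬ Whole.PtLeft r (width⁺ L + c)
    ¬left′ (k′ , k′<c , pk′) with band (width⁺ L) k′
    ... | inside k′<y = n≮0 (subst (k <_) (proj₁ (canon-TL-origin L R r<x k′<y pk′)) k<r)
    ... | beyond k″  = ¬left (k″ , +-cancelˡ-< (width⁺ L) k″ c k′<c , trans (sym (canon-TR L R k″ r<x)) pk′)
  parentCondition-TR {r} {c} r<x (inj₂ (inj₂ (¬above , (k , k<c , pk)))) =
    inj₂ ( (λ (k′ , k′<r , pk′) → ¬above (k′ , k′<r , trans (sym (canon-TR L R c (<-trans k′<r r<x))) pk′))
         , (width⁺ L + k , +-monoʳ-< (width⁺ L) k<c , trans (canon-TR L R k r<x) pk))

  parentCondition-BL : ∀ {r c} → c < width⁺ L → (r ≡ 0 × c ≡ 0) ⊎ Left.ParentCondition r c →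
                       Whole.ParentCondition (height⁺ R + r) c
  parentCondition-BL c<y (inj₁ (refl , refl)) =
    inj₁ ((0 , ≤-trans (height⁺-pos R) (m≤m+n (height⁺ R) 0) , canon-origin L R) , (λ { (_ , () , _) }))
  parentCondition-BL {r} {c} c<y (inj₂ (inj₁ ((k , k<r , pk) , ¬left))) =
    inj₁ ( (height⁺ R + k , +-monoʳ-< (height⁺ R) k<r , trans (canon-BL L R k c<y) pk)
         , (λ (k′ , k′<c , pk′) → ¬left (k′ , k′<c , trans (sym (canon-BL L R r (<-trans k′<c c<y))) pk′)))
  parentCondition-BL {r} {c} c<y (inj₂ (inj₂ (¬above , (k , k<c , pk)))) =
    inj₂ (¬above′ , (k , k<c , trans (canon-BL L R r (<-trans k<c c<y)) pk))
    where
    ¬above′ : ¬ Whole.PtAbove (height⁺ R + r) c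
    ¬above′ (k′ , k′<r , pk′) with band (height⁺ R) k′
    ... | inside k′<x = n≮0 (subst (k <_) (proj₂ (canon-TL-origin L R k′<x c<y pk′)) k<c)
    ... | beyond k″  = ¬above (k″ , +-cancelˡ-< (height⁺ R) k″ r k′<r , trans (sym (canon-BL L R k″ c<y)) pk′)

canon-parent : ∀ T r c → canon T r c ≡ true → ¬ (r ≡ 0 × c ≡ 0) → GridNotions.ParentCondition (canon T) r c
canon-parent (node L R) r c pt ¬o with quadrant (height⁺ R) (width⁺ L) r c
... | TL r<x c<y = contradiction (canon-TL-origin L R r<x c<y pt) ¬o
... | TR c′ r<x  = parentCondition-TR L R r<x
                     (originOr r c′ (canon-parent R r c′ (trans (sym (canon-TR L R c′ r<x)) pt)))
... | BL r′ c<y  = parentCondition-BL L R c<y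
                     (originOr r′ c (canon-parent L r′ c (trans (sym (canon-BL L R r′ c<y)) pt)))
... | BR r′ c′   = contradiction (trans (sym pt) (canon-BR L R r′ c′)) λ ()

canon-noH : ∀ T → ¬ GridNotions.HPattern (canon T)
canon-noH leaf (GridNotions.hPattern _ _ _ _ _ _ _ _ () _ _ _ _)
canon-noH (node L R) (GridNotions.hPattern r₁ r₂ c₁ c₂ c₃ r₁<r₂ c₁<c₂ c₂<c₃ p₁ p₂ p₃ e₁ e₂)
  with band (height⁺ R) r₂
... | beyond r₂′ with band (width⁺ L) c₃
...   | beyond c₃′ = contradiction (trans (sym p₃) (canon-BR L R r₂′ c₃′)) λ ()
...   | inside c₃<y with band (height⁺ R) r₁
...     | inside r₁<x = n≮0 (subst (c₁ <_) (proj₂ (canon-TL-origin L R r₁<x c₂<y p₁)) c₁<c₂)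
  where
  c₂<y : c₂ < width⁺ L
  c₂<y = <-trans c₂<c₃ c₃<y
...     | beyond r₁′ = canon-noH L
  (GridNotions.hPattern r₁′ r₂′ c₁ c₂ c₃ (+-cancelˡ-< (height⁺ R) r₁′ r₂′ r₁<r₂) c₁<c₂ c₂<c₃
    (trans (sym (canon-BL L R r₁′ c₂<y)) p₁) (trans (sym (canon-BL L R r₂′ c₁<y)) p₂)
    (trans (sym (canon-BL L R r₂′ c₃<y)) p₃)
    (trans (sym (canon-BL L R r₁′ c₃<y)) e₁) (trans (sym (canon-BL L R r₂′ c₂<y)) e₂))
  where
  c₂<y : c₂ < width⁺ L
  c₂<y = <-trans c₂<c₃ c₃<y
  c₁<y : c₁ < width⁺ L
  c₁<y = <-trans c₁<c₂ c₂<y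
canon-noH (node L R) (GridNotions.hPattern r₁ r₂ c₁ c₂ c₃ r₁<r₂ c₁<c₂ c₂<c₃ p₁ p₂ p₃ e₁ e₂)
  | inside r₂<x with band (width⁺ L) c₂
... | inside c₂<y = n≮0 (subst (c₁ <_) (proj₂ (canon-TL-origin L R (<-trans r₁<r₂ r₂<x) c₂<y p₁)) c₁<c₂)
... | beyond c₂′ with band (width⁺ L) c₃
...   | inside c₃<y = contradiction (<-trans c₂<c₃ c₃<y) (m+n≮m (width⁺ L) c₂′)
...   | beyond c₃′ with band (width⁺ L) c₁
...     | inside c₁<y = n≮0 (subst (r₁ <_) (proj₁ (canon-TL-origin L R r₂<x c₁<y p₂)) r₁<r₂)
...     | beyond c₁′ = canon-noH R
  (GridNotions.hPattern r₁ r₂ c₁′ c₂′ c₃′ r₁<r₂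
    (+-cancelˡ-< (width⁺ L) c₁′ c₂′ c₁<c₂) (+-cancelˡ-< (width⁺ L) c₂′ c₃′ c₂<c₃)
    (trans (sym (canon-TR L R c₂′ r₁<x)) p₁) (trans (sym (canon-TR L R c₁′ r₂<x)) p₂)
    (trans (sym (canon-TR L R c₃′ r₂<x)) p₃)
    (trans (sym (canon-TR L R c₃′ r₁<x)) e₁) (trans (sym (canon-TR L R c₂′ r₂<x)) e₂))
  where
  r₁<x : r₁ < height⁺ R
  r₁<x = <-trans r₁<r₂ r₂<x

canon-noV : ∀ T → ¬ GridNotions.VPattern (canon T)
canon-noV leaf (GridNotions.vPattern _ _ _ _ _ _ _ _ () _ _ _ _)
canon-noV (node L R) (GridNotions.vPattern r₁ r₂ r₃ c₁ c₂ r₁<r₂ r₂<r₃ c₁<c₂ p₁ p₂ p₃ e₁ e₂)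
  with band (width⁺ L) c₂
... | beyond c₂′ with band (height⁺ R) r₃
...   | beyond r₃′ = contradiction (trans (sym p₃) (canon-BR L R r₃′ c₂′)) λ ()
...   | inside r₃<x with band (width⁺ L) c₁
...     | inside c₁<y = n≮0 (subst (r₁ <_) (proj₁ (canon-TL-origin L R r₂<x c₁<y p₂)) r₁<r₂)
  where
  r₂<x : r₂ < height⁺ R
  r₂<x = <-trans r₂<r₃ r₃<x
...     | beyond c₁′ = canon-noV R
  (GridNotions.vPattern r₁ r₂ r₃ c₁′ c₂′ r₁<r₂ r₂<r₃ (+-cancelˡ-< (width⁺ L) c₁′ c₂′ c₁<c₂)
    (trans (sym (canon-TR L R c₂′ r₁<x)) p₁) (trans (sym (canon-TR L R c₁′ r₂<x)) p₂)
    (trans (sym (canon-TR L R c₂′ r₃<x)) p₃)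
    (trans (sym (canon-TR L R c₂′ r₂<x)) e₁) (trans (sym (canon-TR L R c₁′ r₃<x)) e₂))
  where
  r₂<x : r₂ < height⁺ R
  r₂<x = <-trans r₂<r₃ r₃<x
  r₁<x : r₁ < height⁺ R
  r₁<x = <-trans r₁<r₂ r₂<x
canon-noV (node L R) (GridNotions.vPattern r₁ r₂ r₃ c₁ c₂ r₁<r₂ r₂<r₃ c₁<c₂ p₁ p₂ p₃ e₁ e₂)
  | inside c₂<y with band (height⁺ R) r₁
... | inside r₁<x = n≮0 (subst (c₁ <_) (proj₂ (canon-TL-origin L R r₁<x c₂<y p₁)) c₁<c₂)
... | beyond r₁′ with band (height⁺ R) r₂
...   | inside r₂<x = contradiction (<-trans r₁<r₂ r₂<x) (m+n≮m (height⁺ R) r₁′)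
...   | beyond r₂′ with band (height⁺ R) r₃
...     | inside r₃<x = contradiction (<-trans (<-trans r₁<r₂ r₂<r₃) r₃<x) (m+n≮m (height⁺ R) r₁′)
...     | beyond r₃′ = canon-noV L
  (GridNotions.vPattern r₁′ r₂′ r₃′ c₁ c₂
    (+-cancelˡ-< (height⁺ R) r₁′ r₂′ r₁<r₂) (+-cancelˡ-< (height⁺ R) r₂′ r₃′ r₂<r₃) c₁<c₂
    (trans (sym (canon-BL L R r₁′ c₂<y)) p₁) (trans (sym (canon-BL L R r₂′ c₁<y)) p₂)
    (trans (sym (canon-BL L R r₃′ c₂<y)) p₃)
    (trans (sym (canon-BL L R r₂′ c₂<y)) e₁) (trans (sym (canon-BL L R r₃′ c₁<y)) e₂))
  where
  c₁<y : c₁ < width⁺ L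
  c₁<y = <-trans c₁<c₂ c₂<y

canon-isBaxter : ∀ T → GridNotions.IsBaxterGrid (canon T) (height T) (width T)
canon-isBaxter T = record
  { bounded    = canon-bounded T
  ; parentCond = canon-parent T
  ; rowPointed = canon-rowPointed T
  ; colPointed = canon-colPointed T
  ; noH        = canon-noH T
  ; noV        = canon-noV T
  }

Agrees : Grid → ℕ → ℕ → BT → Set
Agrees g i j T = ∀ r c → g (i + r) (j + c) ≡ canon T r c

canon-beyondWidth⁺ : ∀ T r c → canon T r (width⁺ T + c) ≡ false
canon-beyondWidth⁺ T r c = ¬-not λ pt →
  <⇒≱ (proj₂ (canon-bounded T r _ pt)) (≤-trans (width≤width⁺ T) (m≤m+n (width⁺ T) c))

canon-beyondHeight⁺ : ∀ T r c → canon T (height⁺ T + r) c ≡ false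
canon-beyondHeight⁺ T r c = ¬-not λ pt →
  <⇒≱ (proj₁ (canon-bounded T _ c pt)) (≤-trans (height≤height⁺ T) (m≤m+n (height⁺ T) r))

canon-col₀-gap : ∀ L R {r} → 0 < r → r < height⁺ R → canon (node L R) r 0 ≡ false
canon-col₀-gap L R {r} 0<r r<h =
  trans (canon-TL L R r<h (width⁺-pos L)) (isOrigin-false r 0 λ (r≡0 , _) → <-irrefl (sym r≡0) 0<r)

canon-row₀-gap : ∀ L R {c} → 0 < c → c < width⁺ L → canon (node L R) 0 c ≡ false
canon-row₀-gap L R {c} 0<c c<w =
  trans (canon-TL L R (height⁺-pos R) c<w) (isOrigin-false 0 c λ (_ , c≡0) → <-irrefl (sym c≡0) 0<c)

canon-noLeftChild : ∀ R {r} → 0 < r → canon (node leaf R) r 0 ≡ false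
canon-noLeftChild R {r} 0<r with band (height⁺ R) r
... | inside r<h = canon-col₀-gap leaf R 0<r r<h
... | beyond r′  = canon-BL leaf R r′ (s≤s z≤n)

canon-noRightChild : ∀ L {c} → 0 < c → canon (node L leaf) 0 c ≡ false
canon-noRightChild L {c} 0<c with band (width⁺ L) c
... | inside c<w = canon-row₀-gap L leaf 0<c c<w
... | beyond c′  = canon-TR L leaf c′ (s≤s z≤n)

offset-pos : ∀ i {r} → i < i + r → 0 < r
offset-pos i {r} i<i+r = +-cancelˡ-< i 0 r (subst (_< i + r) (sym (+-identityʳ i)) i<i+r)

m+n≡m⇒n≡0 : ∀ m {n} → m + n ≡ m → n ≡ 0
m+n≡m⇒n≡0 m {n} e = +-cancelˡ-≡ m n 0 (trans e (sym (+-identityʳ m)))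

sumInduction : (P : ℕ → ℕ → Set) →
  (∀ r c → (∀ r′ c′ → r′ + c′ < r + c → P r′ c′) → P r c) → ∀ r c → P r c
sumInduction P step r c = belowBound (suc (r + c)) r c ≤-refl
  where
  belowBound : ∀ n r c → r + c < n → P r c
  belowBound (suc n) r c r+c<n = step r c λ r′ c′ lt → belowBound n r′ c′ (<-≤-trans lt (s≤s⁻¹ r+c<n))

greatestBelow : (f : ℕ → Bool) (r : ℕ) → ∃[ k ] (k < r × f k ≡ true) →
  ∃[ k ] (k < r × f k ≡ true × (∀ k′ → k < k′ → k′ < r → f k′ ≢ true))
greatestBelow f zero (k , () , _)
greatestBelow f (suc r) (k , k<1+r , fk) with f r in fr
... | true  = r , ≤-refl , fr , λ k′ r<k′ k′<1+r _ → <⇒≱ r<k′ (s≤s⁻¹ k′<1+r)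
... | false with k ≟ r
...   | yes refl = contradiction (trans (sym fk) fr) λ ()
...   | no k≢r with greatestBelow f r (k , ≤∧≢⇒< (s≤s⁻¹ k<1+r) k≢r , fk)
...     | k₀ , k₀<r , fk₀ , none = k₀ , m<n⇒m<1+n k₀<r , fk₀ , none′
  where
  none′ : ∀ k′ → k₀ < k′ → k′ < suc r → f k′ ≢ true
  none′ k′ k₀<k′ k′<1+r fk′ with k′ ≟ r
  ... | yes refl = contradiction (trans (sym fk′) fr) λ ()
  ... | no k′≢r  = none k′ k₀<k′ (≤∧≢⇒< (s≤s⁻¹ k′<1+r) k′≢r) fk′

module Uniqueness (g : Grid) {H W : ℕ} (B : GridNotions.IsBaxterGrid g H W) where
  open GridNotions g
  open IsBaxterGrid B

  parentOf : ∀ {r c} → Pt r c → ¬ (r ≡ 0 × c ≡ 0) → (∃[ k ] LeftC k c r) ⊎ (∃[ k ] RightC r k c)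
  parentOf {r} {c} pt ¬o with parentCond r c pt ¬o
  ... | inj₁ (above , ¬left) with greatestBelow (λ k → g k c) r above
  ...   | k , k<r , pk , gap = inj₁ (k , leftC pk pt k<r gap λ k′ k′<c pk′ → ¬left (k′ , k′<c , pk′))
  parentOf {r} {c} pt ¬o | inj₂ (¬above , left) with greatestBelow (λ k → g r k) c left
  ...   | k , k<c , pk , gap = inj₂ (k , rightC pk pt k<c gap λ k′ k′<r pk′ → ¬above (k′ , k′<r , pk′))

  -- A parent outside the quadrant below and to the right of a point (i , j) would form a V
  -- (resp. an H) with it.
  leftParent-inQuadrant : ∀ {i j r c k} → Pt i j → i ≤ r → j ≤ c → ¬ (r ≡ i × c ≡ j) →
                          LeftC k c r → i ≤ k
  leftParent-inQuadrant {i} {j} {r} {c} {k} pij i≤r j≤c ≢ij (leftC pk pr k<r gap leftmost) with i ≤? k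
  ... | yes i≤k = i≤k
  ... | no i≰k with ≰⇒> i≰k | m≤n⇒m<n∨m≡n i≤r | m≤n⇒m<n∨m≡n j≤c
  ...   | k<i | inj₂ refl | inj₂ refl = contradiction (refl , refl) ≢ij
  ...   | k<i | inj₁ i<r  | inj₂ refl = contradiction pij (gap i k<i i<r)
  ...   | k<i | inj₂ refl | inj₁ j<c  = contradiction pij (leftmost j j<c)
  ...   | k<i | inj₁ i<r  | inj₁ j<c  =
    contradiction (vPattern k i r j c k<i i<r j<c pk pij pr (¬-not (gap i k<i i<r)) (¬-not (leftmost j j<c))) noV

  rightParent-inQuadrant : ∀ {i j r c k} → Pt i j → i ≤ r → j ≤ c → ¬ (r ≡ i × c ≡ j) →
                           RightC r k c → j ≤ k
  rightParent-inQuadrant {i} {j} {r} {c} {k} pij i≤r j≤c ≢ij (rightC pk pr k<c gap topmost) with j ≤? k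
  ... | yes j≤k = j≤k
  ... | no j≰k with ≰⇒> j≰k | m≤n⇒m<n∨m≡n i≤r | m≤n⇒m<n∨m≡n j≤c
  ...   | k<j | inj₂ refl | inj₂ refl = contradiction (refl , refl) ≢ij
  ...   | k<j | inj₂ refl | inj₁ j<c  = contradiction pij (gap j k<j j<c)
  ...   | k<j | inj₁ i<r  | inj₂ refl = contradiction pij (topmost i i<r)
  ...   | k<j | inj₁ i<r  | inj₁ j<c  =
    contradiction (hPattern i r k j c i<r k<j j<c pij pk pr (¬-not (topmost i i<r)) (¬-not (gap j k<j j<c))) noH

  -- The parent chain of a point beyond both (i′ , j) and (i , j′) never leaves that region,
  -- yet it must reach the origin.
  beyondBoth-empty : ∀ {i j i′ j′} → i < i′ → j < j′ → Pt i′ j → Pt i j′ →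
                     ∀ {r c} → i′ ≤ r → j′ ≤ c → ¬ Pt r c
  beyondBoth-empty {i} {j} {i′} {j′} i<i′ j<j′ pa pb {r} {c} = sumInduction P step r c
    where
    P : ℕ → ℕ → Set
    P r c = i′ ≤ r → j′ ≤ c → ¬ Pt r c
    step : ∀ r c → (∀ r′ c′ → r′ + c′ < r + c → P r′ c′) → P r c
    step r c ih i′≤r j′≤c pr
      with parentOf pr (λ (r≡0 , _) → n≮0 (subst (i <_) r≡0 (<-≤-trans i<i′ i′≤r)))
    ... | inj₁ (k , lc) =
      ih k c (+-monoˡ-< c (LeftC.below lc))
         (leftParent-inQuadrant pa i′≤r (≤-trans (<⇒≤ j<j′) j′≤c)
            (λ (_ , c≡j) → <-irrefl (sym c≡j) (<-≤-trans j<j′ j′≤c)) lc)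
         j′≤c (LeftC.parent lc)
    ... | inj₂ (k , rc) =
      ih r k (+-monoʳ-< r (RightC.right rc)) i′≤r
         (rightParent-inQuadrant pb (≤-trans (<⇒≤ i<i′) i′≤r) j′≤c
            (λ (r≡i , _) → <-irrefl (sym r≡i) (<-≤-trans i<i′ i′≤r)) rc)
         (RightC.parent rc)

  InLeftQuadrant : ∀ {i j L} → GLeftSub i j L → ℕ → ℕ → Set
  InLeftQuadrant (noL _)               r c = ⊥
  InLeftQuadrant {j = j} (hasL i′ _ _) r c = i′ ≤ r × j ≤ c

  InRightQuadrant : ∀ {i j R} → GRightSub i j R → ℕ → ℕ → Set
  InRightQuadrant (noR _)               r c = ⊥
  InRightQuadrant {i = i} (hasR j′ _ _) r c = i ≤ r × j′ ≤ c

  Covered : ∀ {i j L R} → GLeftSub i j L → GRightSub i j R → ℕ → ℕ → Set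
  Covered gl gr r c = InLeftQuadrant gl r c ⊎ InRightQuadrant gr r c

  covered-mono : ∀ {i j L R} (gl : GLeftSub i j L) (gr : GRightSub i j R) {r c r′ c′} →
                 r ≤ r′ → c ≤ c′ → Covered gl gr r c → Covered gl gr r′ c′
  covered-mono (hasL _ _ _) gr r≤r′ c≤c′ (inj₁ (a , b)) = inj₁ (≤-trans a r≤r′ , ≤-trans b c≤c′)
  covered-mono gl (hasR _ _ _) r≤r′ c≤c′ (inj₂ (a , b)) = inj₂ (≤-trans a r≤r′ , ≤-trans b c≤c′)

  leftChild-unique : ∀ {i j a b} → LeftC i j a → LeftC i j b → a ≡ b
  leftChild-unique {a = a} {b} (leftC _ pa i<a gapa _) (leftC _ pb i<b gapb _) with <-cmp a b
  ... | tri< a<b _ _ = contradiction pa (gapb a i<a a<b)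
  ... | tri≈ _ a≡b _ = a≡b
  ... | tri> _ _ b<a = contradiction pb (gapa b i<b b<a)

  rightChild-unique : ∀ {i j a b} → RightC i j a → RightC i j b → a ≡ b
  rightChild-unique {a = a} {b} (rightC _ pa j<a gapa _) (rightC _ pb j<b gapb _) with <-cmp a b
  ... | tri< a<b _ _ = contradiction pa (gapb a j<a a<b)
  ... | tri≈ _ a≡b _ = a≡b
  ... | tri> _ _ b<a = contradiction pb (gapa b j<b b<a)

  leftChild-covered : ∀ {i j L R r} (gl : GLeftSub i j L) (gr : GRightSub i j R) → LeftC i j r → Covered gl gr r j
  leftChild-covered (noL none) gr lc = contradiction lc (none _)
  leftChild-covered (hasL _ lc′ _) gr lc = inj₁ (≤-reflexive (leftChild-unique lc′ lc) , ≤-refl)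

  rightChild-covered : ∀ {i j L R c} (gl : GLeftSub i j L) (gr : GRightSub i j R) → RightC i j c → Covered gl gr i c
  rightChild-covered gl (noR none) rc = contradiction rc (none _)
  rightChild-covered gl (hasR _ rc′ _) rc = inj₂ (≤-refl , ≤-reflexive (rightChild-unique rc′ rc))

  beyond-notOrigin : ∀ {i j r c} → i ≤ r → j ≤ c → ¬ (r ≡ i × c ≡ j) → ¬ (r ≡ 0 × c ≡ 0)
  beyond-notOrigin z≤n z≤n ≢ij (refl , refl) = ≢ij (refl , refl)

  -- The parent chain of a point in the quadrant of (i , j) stays in that quadrant, so it reaches
  -- (i , j) through one of its children.
  quadrant-covered : ∀ {i j L R} (gl : GLeftSub i j L) (gr : GRightSub i j R) → Pt i j →
                     ∀ {r c} → Pt r c → i ≤ r → j ≤ c → ¬ (r ≡ i × c ≡ j) → Covered gl gr r c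
  quadrant-covered {i} {j} gl gr pij {r} {c} = sumInduction P step r c
    where
    P : ℕ → ℕ → Set
    P r c = Pt r c → i ≤ r → j ≤ c → ¬ (r ≡ i × c ≡ j) → Covered gl gr r c
    step : ∀ r c → (∀ r′ c′ → r′ + c′ < r + c → P r′ c′) → P r c
    step r c ih pr i≤r j≤c ≢ij with parentOf pr (beyond-notOrigin i≤r j≤c ≢ij)
    ... | inj₁ (k , lc) with (k ≟ i) ×-dec (c ≟ j)
    ...   | yes (refl , refl) = leftChild-covered gl gr lc
    ...   | no ≢ij′ = covered-mono gl gr (<⇒≤ (LeftC.below lc)) ≤-refl
                        (ih k c (+-monoˡ-< c (LeftC.below lc)) (LeftC.parent lc)
                            (leftParent-inQuadrant pij i≤r j≤c ≢ij lc) j≤c ≢ij′)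
    step r c ih pr i≤r j≤c ≢ij | inj₂ (k , rc) with (r ≟ i) ×-dec (k ≟ j)
    ...   | yes (refl , refl) = rightChild-covered gl gr rc
    ...   | no ≢ij′ = covered-mono gl gr ≤-refl (<⇒≤ (RightC.right rc))
                        (ih r k (+-monoʳ-< r (RightC.right rc)) (RightC.parent rc)
                            i≤r (rightParent-inQuadrant pij i≤r j≤c ≢ij rc) ≢ij′)

  leftEdge-westEmpty : ∀ {i j i′} → LeftC i j i′ → ∀ {r c} → i < r → r < i′ → c < j → ¬ Pt r c
  leftEdge-westEmpty {i} {j} {i′} (leftC pij pi′j _ gap leftmost) {r} {c} i<r r<i′ c<j prc =
    noV (vPattern i r i′ c j i<r r<i′ c<j pij prc pi′j (¬-not (gap r i<r r<i′)) (¬-not (leftmost c c<j)))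

  rightEdge-northEmpty : ∀ {i j j′} → RightC i j j′ → ∀ {r c} → r < i → j < c → c < j′ → ¬ Pt r c
  rightEdge-northEmpty {i} {j} {j′} (rightC pij pij′ _ gap topmost) {r} {c} r<i j<c c<j′ prc =
    noH (hPattern r i j c j′ r<i j<c c<j′ prc pij pij′ (¬-not (topmost r r<i)) (¬-not (gap c j<c c<j′)))

  leftEdge-rowCovered : ∀ {i j i′ L R} (lc : LeftC i j i′) (sL : GSub i′ j L) (gr : GRightSub i j R) →
                        ∀ {r} → i < r → r < i′ → ∃[ c ] (InRightQuadrant gr r c × Pt r c)
  leftEdge-rowCovered {i} {j} lc sL gr {r} i<r r<i′
    with rowPointed r (<-trans r<i′ (proj₁ (bounded _ _ (LeftC.child lc))))
  ... | c , prc with c <? j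
  ...   | yes c<j = contradiction prc (leftEdge-westEmpty lc i<r r<i′ c<j)
  ...   | no c≮j with quadrant-covered (hasL _ lc sL) gr (LeftC.parent lc) prc (<⇒≤ i<r) (≮⇒≥ c≮j)
                        (λ (r≡i , _) → <-irrefl (sym r≡i) i<r)
  ...     | inj₁ (i′≤r , _) = contradiction i′≤r (<⇒≱ r<i′)
  ...     | inj₂ q          = c , q , prc

  rightEdge-colCovered : ∀ {i j j′ L R} (gl : GLeftSub i j L) (rc : RightC i j j′) (sR : GSub i j′ R) →
                         ∀ {c} → j < c → c < j′ → ∃[ r ] (InLeftQuadrant gl r c × Pt r c)
  rightEdge-colCovered {i} {j} gl rc sR {c} j<c c<j′
    with colPointed c (<-trans c<j′ (proj₂ (bounded _ _ (RightC.child rc))))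
  ... | r , prc with r <? i
  ...   | yes r<i = contradiction prc (rightEdge-northEmpty rc r<i j<c c<j′)
  ...   | no r≮i with quadrant-covered gl (hasR _ rc sR) (RightC.parent rc) prc (≮⇒≥ r≮i) (<⇒≤ j<c)
                        (λ (_ , c≡j) → <-irrefl (sym c≡j) j<c)
  ...     | inj₁ q          = r , q , prc
  ...     | inj₂ (_ , j′≤c) = contradiction j′≤c (<⇒≱ c<j′)

  LeftAgrees : ∀ {i j L} → GLeftSub i j L → Set
  LeftAgrees (noL _)                   = ⊤
  LeftAgrees {j = j} {L} (hasL i′ _ _) = Agrees g i′ j L

  RightAgrees : ∀ {i j R} → GRightSub i j R → Set
  RightAgrees (noR _)                   = ⊤
  RightAgrees {i = i} {R = R} (hasR j′ _ _) = Agrees g i j′ R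

  agrees-pointed : ∀ {i j T r c} → Agrees g i j T → i ≤ r → j ≤ c → Pt r c →
                   ∃[ r′ ] ∃[ c′ ] canon T r′ c′ ≡ true × r ≡ i + r′ × c ≡ j + c′
  agrees-pointed agree i≤r j≤c prc with m≤n⇒∃[o]m+o≡n i≤r | m≤n⇒∃[o]m+o≡n j≤c
  ... | r′ , refl | c′ , refl = r′ , c′ , trans (sym (agree r′ c′)) prc , refl , refl

  rightQuadrant-rowBound : ∀ {i j R} (gr : GRightSub i j R) → RightAgrees gr →
                           ∀ {r c} → InRightQuadrant gr r c → Pt r c → r < i + height R
  rightQuadrant-rowBound {i} {R = R} (hasR j′ _ _) agree (i≤r , j′≤c) prc
    with agrees-pointed {T = R} agree i≤r j′≤c prc
  ... | r′ , c′ , pt , refl , _ = +-monoʳ-< i (proj₁ (canon-bounded R r′ c′ pt))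

  leftQuadrant-colBound : ∀ {i j L} (gl : GLeftSub i j L) → LeftAgrees gl →
                          ∀ {r c} → InLeftQuadrant gl r c → Pt r c → c < j + width L
  leftQuadrant-colBound {j = j} {L} (hasL i′ _ _) agree (i′≤r , j≤c) prc
    with agrees-pointed {T = L} agree i′≤r j≤c prc
  ... | r′ , c′ , pt , _ , refl = +-monoʳ-< j (proj₂ (canon-bounded L r′ c′ pt))

  rightQuadrant-rowPointed : ∀ {i j R} (gr : GRightSub i j R) → RightAgrees gr →
                             ∀ {r} → i < r → r < i + height⁺ R → ∃[ c ] (InRightQuadrant gr r c × Pt r c)
  rightQuadrant-rowPointed {i} (noR _) _ {r} i<r r<i+1 =
    contradiction (s≤s⁻¹ (subst (r <_) (+-comm i 1) r<i+1)) (<⇒≱ i<r)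
  rightQuadrant-rowPointed {i} {R = R} (hasR j′ _ (gv _ _ _)) agree {r} i<r r<i+h
    with m≤n⇒∃[o]m+o≡n (<⇒≤ i<r)
  ... | r′ , refl with canon-rowPointed R r′ (+-cancelˡ-< i r′ (height R) r<i+h)
  ...   | c′ , pt = j′ + c′ , (<⇒≤ i<r , m≤m+n j′ c′) , trans (agree r′ c′) pt

  leftQuadrant-colPointed : ∀ {i j L} (gl : GLeftSub i j L) → LeftAgrees gl →
                            ∀ {c} → j < c → c < j + width⁺ L → ∃[ r ] (InLeftQuadrant gl r c × Pt r c)
  leftQuadrant-colPointed {j = j} (noL _) _ {c} j<c c<j+1 =
    contradiction (s≤s⁻¹ (subst (c <_) (+-comm j 1) c<j+1)) (<⇒≱ j<c)
  leftQuadrant-colPointed {j = j} {L} (hasL i′ _ (gv _ _ _)) agree {c} j<c c<j+w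
    with m≤n⇒∃[o]m+o≡n (<⇒≤ j<c)
  ... | c′ , refl with canon-colPointed L c′ (+-cancelˡ-< j c′ (width L) c<j+w)
  ...   | r′ , pt = i′ + r′ , (m≤m+n i′ r′ , <⇒≤ j<c) , trans (agree r′ c′) pt

  rightQuadrant-belowLeftChild-empty : ∀ {i j i′ R} → LeftC i j i′ → (gr : GRightSub i j R) →
                                       ∀ {r c} → InRightQuadrant gr r c → i′ ≤ r → ¬ Pt r c
  rightQuadrant-belowLeftChild-empty lc (hasR _ rc _) (_ , j′≤c) i′≤r =
    beyondBoth-empty (LeftC.below lc) (RightC.right rc) (LeftC.child lc) (RightC.child rc) i′≤r j′≤c

  leftQuadrant-rightOfRightChild-empty : ∀ {i j j′ L} → RightC i j j′ → (gl : GLeftSub i j L) →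
                                         ∀ {r c} → InLeftQuadrant gl r c → j′ ≤ c → ¬ Pt r c
  leftQuadrant-rightOfRightChild-empty rc (hasL _ lc _) (i′≤r , _) j′≤c =
    beyondBoth-empty (LeftC.below lc) (RightC.right rc) (LeftC.child lc) (RightC.child rc) i′≤r j′≤c

  -- The rows strictly between a vertex and its left child are exactly those carrying the right subtree.
  leftChild-row : ∀ {i j i′ L R} (lc : LeftC i j i′) → GSub i′ j L → (gr : GRightSub i j R) → RightAgrees gr →
                  i′ ≡ i + height⁺ R
  leftChild-row {i} {i′ = i′} {R = R} lc sL gr agree = ≤-antisym (≮⇒≥ tooLow) (≮⇒≥ tooHigh)
    where
    tooLow : ¬ i + height⁺ R < i′
    tooLow lt = let _ , q , prc = leftEdge-rowCovered lc sL gr (m<m+n i (height⁺-pos R)) lt in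
      <⇒≱ (rightQuadrant-rowBound gr agree q prc) (+-monoʳ-≤ i (height≤height⁺ R))
    tooHigh : ¬ i′ < i + height⁺ R
    tooHigh lt = let _ , q , prc = rightQuadrant-rowPointed gr agree (LeftC.below lc) lt in
      rightQuadrant-belowLeftChild-empty lc gr q ≤-refl prc

  rightChild-col : ∀ {i j j′ L R} (gl : GLeftSub i j L) → LeftAgrees gl → (rc : RightC i j j′) → GSub i j′ R →
                   j′ ≡ j + width⁺ L
  rightChild-col {j = j} {j′} {L} gl agree rc sR = ≤-antisym (≮⇒≥ tooFar) (≮⇒≥ tooNear)
    where
    tooFar : ¬ j + width⁺ L < j′
    tooFar lt = let _ , q , prc = rightEdge-colCovered gl rc sR (m<m+n j (width⁺-pos L)) lt in
      <⇒≱ (leftQuadrant-colBound gl agree q prc) (+-monoʳ-≤ j (width≤width⁺ L))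
    tooNear : ¬ j′ < j + width⁺ L
    tooNear lt = let _ , q , prc = leftQuadrant-colPointed gl agree (RightC.right rc) lt in
      leftQuadrant-rightOfRightChild-empty rc gl q ≤-refl prc

  leftQuadrant-rowFloor : ∀ {i j L R} (gl : GLeftSub i j L) (gr : GRightSub i j R) → RightAgrees gr →
                          ∀ {r c} → InLeftQuadrant gl r c → i + height⁺ R ≤ r
  leftQuadrant-rowFloor (hasL _ lc sL) gr agree (i′≤r , _) = subst (_≤ _) (leftChild-row lc sL gr agree) i′≤r

  rightQuadrant-colFloor : ∀ {i j L R} (gl : GLeftSub i j L) → LeftAgrees gl → (gr : GRightSub i j R) →
                           ∀ {r c} → InRightQuadrant gr r c → j + width⁺ L ≤ c
  rightQuadrant-colFloor gl agree (hasR _ rc sR) (_ , j′≤c) = subst (_≤ _) (rightChild-col gl agree rc sR) j′≤c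

  module _ {i j} (pij : Pt i j) {L R : BT} where

    agree-TL : (gl : GLeftSub i j L) → LeftAgrees gl → (gr : GRightSub i j R) → RightAgrees gr →
               ∀ {r c} → r < height⁺ R → c < width⁺ L → g (i + r) (j + c) ≡ isOrigin r c
    agree-TL gl al gr ar {r} {c} r<h c<w with (r ≟ 0) ×-dec (c ≟ 0)
    ... | yes (refl , refl) = subst₂ (λ a b → g a b ≡ true) (sym (+-identityʳ i)) (sym (+-identityʳ j)) pij
    ... | no ¬o = trans (¬-not λ pt → [ (λ q → <⇒≱ (+-monoʳ-< i r<h) (leftQuadrant-rowFloor gl gr ar q))
                                       , (λ q → <⇒≱ (+-monoʳ-< j c<w) (rightQuadrant-colFloor gl al gr q)) ]′
                                       (quadrant-covered gl gr pij pt (m≤m+n i r) (m≤m+n j c) notVertex))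
                        (sym (isOrigin-false r c ¬o))
      where
      notVertex : ¬ (i + r ≡ i × j + c ≡ j)
      notVertex (e₁ , e₂) = ¬o (m+n≡m⇒n≡0 i e₁ , m+n≡m⇒n≡0 j e₂)

    agree-right : (gl : GLeftSub i j L) → LeftAgrees gl → (gr : GRightSub i j R) → RightAgrees gr →
                  ∀ r c → g (i + r) (j + (width⁺ L + c)) ≡ canon R r c
    agree-right gl al (hasR j′ rc sR) ar r c =
      trans (cong (g (i + r))
                  (trans (sym (+-assoc j (width⁺ L) c)) (cong (_+ c) (sym (rightChild-col gl al rc sR)))))
            (ar r c)
    agree-right gl al (noR none) _ r c = ¬-not λ pt →
      [ (λ q → <⇒≱ (leftQuadrant-colBound gl al q pt)
                   (+-monoʳ-≤ j (≤-trans (width≤width⁺ L) (m≤m+n _ c))))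
      , (λ ()) ]′
      (quadrant-covered gl (noR none) pij pt (m≤m+n i r) (m≤m+n j _)
         λ (_ , e) → <-irrefl (sym e) (m<m+n j (≤-trans (width⁺-pos L) (m≤m+n _ c))))

    agree-below : (gl : GLeftSub i j L) → LeftAgrees gl → (gr : GRightSub i j R) → RightAgrees gr →
                  ∀ r c → g (i + (height⁺ R + r)) (j + c) ≡ canon L r c
    agree-below (hasL i′ lc sL) al gr ar r c =
      trans (cong (λ z → g z (j + c))
                  (trans (sym (+-assoc i (height⁺ R) r)) (cong (_+ r) (sym (leftChild-row lc sL gr ar)))))
            (al r c)
    agree-below (noL none) _ gr ar r c = ¬-not λ pt →
      [ (λ ())
      , (λ q → <⇒≱ (rightQuadrant-rowBound gr ar q pt)
                   (+-monoʳ-≤ i (≤-trans (height≤height⁺ R) (m≤m+n _ r)))) ]′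
      (quadrant-covered (noL none) gr pij pt (m≤m+n i _) (m≤m+n j c)
         λ (e , _) → <-irrefl (sym e) (m<m+n i (≤-trans (height⁺-pos R) (m≤m+n _ r))))

    agrees-node : (gl : GLeftSub i j L) → LeftAgrees gl → (gr : GRightSub i j R) → RightAgrees gr →
                  Agrees g i j (node L R)
    agrees-node gl al gr ar r c with quadrant (height⁺ R) (width⁺ L) r c
    ... | TL r<h c<w = trans (agree-TL gl al gr ar r<h c<w) (sym (canon-TL L R r<h c<w))
    ... | TR c′ r<h  = trans (agree-right gl al gr ar r c′) (sym (canon-TR L R c′ r<h))
    ... | BL r′ c<w  = trans (agree-below gl al gr ar r′ c) (sym (canon-BL L R r′ c<w))
    ... | BR r′ c′   = trans (agree-below gl al gr ar r′ (width⁺ L + c′))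
                             (trans (canon-beyondWidth⁺ L r′ c′) (sym (canon-BR L R r′ c′)))

  sub-agrees : ∀ {i j T} → GSub i j T → Agrees g i j T
  leftSub-agrees : ∀ {i j L} (gl : GLeftSub i j L) → LeftAgrees gl
  rightSub-agrees : ∀ {i j R} (gr : GRightSub i j R) → RightAgrees gr

  sub-agrees (gv pij gl gr) = agrees-node pij gl (leftSub-agrees gl) gr (rightSub-agrees gr)
  leftSub-agrees (noL _)        = tt
  leftSub-agrees (hasL _ _ s)   = sub-agrees s
  rightSub-agrees (noR _)       = tt
  rightSub-agrees (hasR _ _ s)  = sub-agrees s

module Existence (g : Grid) where
  open GridNotions g

  -- Agreement alone does not make (i , j) the root of a copy of T: the children read off the
  -- block must also have no point to their left, resp. above them.
  record Placed (i j : ℕ) (T : BT) : Set where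
    field
      agrees     : Agrees g i j T
      westClear  : ∀ r c → 0 < r → r < height T → c < j → g (i + r) c ≡ false
      northClear : ∀ r c → 0 < c → c < width T → r < i → g r (j + c) ≡ false
  open Placed

  placed-col₀ : ∀ {i j T} → Placed i j T → ∀ r → g (i + r) j ≡ canon T r 0
  placed-col₀ {i} {j} p r = trans (cong (g (i + r)) (sym (+-identityʳ j))) (agrees p r 0)

  placed-row₀ : ∀ {i j T} → Placed i j T → ∀ c → g i (j + c) ≡ canon T 0 c
  placed-row₀ {i} {j} p c = trans (cong (λ a → g a (j + c)) (sym (+-identityʳ i))) (agrees p 0 c)

  module _ {i j L R} (p : Placed i j (node L R)) where

    placed-vertex : Pt i j
    placed-vertex = trans (cong (λ a → g a j) (sym (+-identityʳ i))) (trans (placed-col₀ p 0) (canon-origin L R))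

    placed-left : Placed (i + height⁺ R) j L
    placed-left = record { agrees = agreesL ; westClear = westL ; northClear = northL }
      where
      agreesL : Agrees g (i + height⁺ R) j L
      agreesL r c with band (width⁺ L) c
      ... | inside c<w = trans (cong (λ a → g a (j + c)) (+-assoc i (height⁺ R) r))
                               (trans (agrees p (height⁺ R + r) c) (canon-BL L R r c<w))
      ... | beyond c′  = trans (cong (λ a → g a (j + (width⁺ L + c′))) (+-assoc i (height⁺ R) r))
                               (trans (agrees p (height⁺ R + r) (width⁺ L + c′))
                                      (trans (canon-BR L R r c′) (sym (canon-beyondWidth⁺ L r c′))))
      westL : ∀ r c → 0 < r → r < height L → c < j → g ((i + height⁺ R) + r) c ≡ false
      westL r c 0<r r<h c<j = trans (cong (λ a → g a c) (+-assoc i (height⁺ R) r))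
        (westClear p (height⁺ R + r) c (<-≤-trans 0<r (m≤n+m r _))
           (subst (height⁺ R + r <_) (+-comm (height⁺ R) (height L)) (+-monoʳ-< (height⁺ R) r<h)) c<j)
      northL : ∀ r c → 0 < c → c < width L → r < i + height⁺ R → g r (j + c) ≡ false
      northL r c 0<c c<w r<i+h with band i r
      ... | inside r<i = northClear p r c 0<c (<-≤-trans c<w (≤-trans (width≤width⁺ L) (m≤m+n _ (width R)))) r<i
      ... | beyond r′  = trans (agrees p r′ c)
        (trans (canon-TL L R (+-cancelˡ-< i r′ _ r<i+h) (<-≤-trans c<w (width≤width⁺ L)))
               (isOrigin-false r′ c λ (_ , c≡0) → <-irrefl (sym c≡0) 0<c))

    placed-right : Placed i (j + width⁺ L) R
    placed-right = record { agrees = agreesR ; westClear = westR ; northClear = northR }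
      where
      agreesR : Agrees g i (j + width⁺ L) R
      agreesR r c with band (height⁺ R) r
      ... | inside r<h = trans (cong (g (i + r)) (+-assoc j (width⁺ L) c))
                               (trans (agrees p r (width⁺ L + c)) (canon-TR L R c r<h))
      ... | beyond r′  = trans (cong (g (i + (height⁺ R + r′))) (+-assoc j (width⁺ L) c))
                               (trans (agrees p (height⁺ R + r′) (width⁺ L + c))
                                      (trans (canon-BR L R r′ c) (sym (canon-beyondHeight⁺ R r′ c))))
      northR : ∀ r c → 0 < c → c < width R → r < i → g r ((j + width⁺ L) + c) ≡ false
      northR r c 0<c c<w r<i = trans (cong (g r) (+-assoc j (width⁺ L) c))
        (northClear p r (width⁺ L + c) (<-≤-trans 0<c (m≤n+m c _)) (+-monoʳ-< (width⁺ L) c<w) r<i)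
      westR : ∀ r c → 0 < r → r < height R → c < j + width⁺ L → g (i + r) c ≡ false
      westR r c 0<r r<h c<j+w with band j c
      ... | inside c<j = westClear p r c 0<r (<-≤-trans r<h (≤-trans (height≤height⁺ R) (m≤n+m _ (height L)))) c<j
      ... | beyond c′  = trans (agrees p r c′)
        (trans (canon-TL L R (<-≤-trans r<h (height≤height⁺ R)) (+-cancelˡ-< j c′ _ c<j+w))
               (isOrigin-false r c′ λ (r≡0 , _) → <-irrefl (sym r≡0) 0<r))

  placed-leftChild : ∀ {i j LL LR R} → Placed i j (node (node LL LR) R) → LeftC i j (i + height⁺ R)
  placed-leftChild {i} {j} {LL} {LR} {R} p =
    leftC (placed-vertex p) (placed-vertex (placed-left p)) (m<m+n i (height⁺-pos R)) gap leftmost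
    where
    gap : ∀ k → i < k → k < i + height⁺ R → ¬ Pt k j
    gap k i<k k<i+h with m≤n⇒∃[o]m+o≡n (<⇒≤ i<k)
    ... | r , refl = not-¬ (trans (placed-col₀ p r)
                                  (canon-col₀-gap (node LL LR) R (offset-pos i i<k) (+-cancelˡ-< i r _ k<i+h)))
    leftmost : ∀ k → k < j → ¬ Pt (i + height⁺ R) k
    leftmost k k<j =
      not-¬ (westClear p (height⁺ R) k (height⁺-pos R) (m<n+m (height⁺ R) (height⁺-pos (node LL LR))) k<j)

  placed-rightChild : ∀ {i j L RL RR} → Placed i j (node L (node RL RR)) → RightC i j (j + width⁺ L)
  placed-rightChild {i} {j} {L} {RL} {RR} p =
    rightC (placed-vertex p) (placed-vertex (placed-right p)) (m<m+n j (width⁺-pos L)) gap topmost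
    where
    gap : ∀ k → j < k → k < j + width⁺ L → ¬ Pt i k
    gap k j<k k<j+w with m≤n⇒∃[o]m+o≡n (<⇒≤ j<k)
    ... | c , refl = not-¬ (trans (placed-row₀ p c)
                                  (canon-row₀-gap L (node RL RR) (offset-pos j j<k) (+-cancelˡ-< j c _ k<j+w)))
    topmost : ∀ k → k < i → ¬ Pt k (j + width⁺ L)
    topmost k k<i =
      not-¬ (northClear p k (width⁺ L) (width⁺-pos L) (m<m+n (width⁺ L) (width⁺-pos (node RL RR))) k<i)

  placed-noLeftChild : ∀ {i j R} → Placed i j (node leaf R) → ∀ i′ → ¬ LeftC i j i′
  placed-noLeftChild {i} {R = R} p i′ lc with m≤n⇒∃[o]m+o≡n (<⇒≤ (LeftC.below lc))
  ... | r , refl = not-¬ (trans (placed-col₀ p r) (canon-noLeftChild R (offset-pos i (LeftC.below lc))))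
                         (LeftC.child lc)

  placed-noRightChild : ∀ {i j L} → Placed i j (node L leaf) → ∀ j′ → ¬ RightC i j j′
  placed-noRightChild {j = j} {L} p j′ rc with m≤n⇒∃[o]m+o≡n (<⇒≤ (RightC.right rc))
  ... | c , refl = not-¬ (trans (placed-row₀ p c) (canon-noRightChild L (offset-pos j (RightC.right rc))))
                         (RightC.child rc)

  placed-sub : ∀ {i j} T → T ≢ leaf → Placed i j T → GSub i j T
  placed-leftSub : ∀ {i j} L {R} → Placed i j (node L R) → GLeftSub i j L
  placed-rightSub : ∀ {i j L} R → Placed i j (node L R) → GRightSub i j R

  placed-sub leaf       ≢leaf _ = contradiction refl ≢leaf
  placed-sub (node L R) _     p = gv (placed-vertex p) (placed-leftSub L p) (placed-rightSub R p)
  placed-leftSub leaf          p = noL (placed-noLeftChild p)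
  placed-leftSub (node LL LR)  p = hasL _ (placed-leftChild p) (placed-sub (node LL LR) (λ ()) (placed-left p))
  placed-rightSub leaf         p = noR (placed-noRightChild p)
  placed-rightSub (node RL RR) p = hasR _ (placed-rightChild p) (placed-sub (node RL RR) (λ ()) (placed-right p))

gridOf : ∀ {h w} → Vec (Vec Bool w) h → Grid
gridOf {h} {w} rows r c with r <? h | c <? w
... | yes r<h | yes c<w = lookup (lookup rows (fromℕ< r<h)) (fromℕ< c<w)
... | _       | _       = false

module _ {h w} (rows : Vec (Vec Bool w) h) where

  gridOf-lookup : ∀ i j → gridOf rows (toℕ i) (toℕ j) ≡ lookup (lookup rows i) j
  gridOf-lookup i j with toℕ i <? h | toℕ j <? w
  ... | yes i<h | yes j<w = cong₂ (λ a b → lookup (lookup rows a) b) (fromℕ<-toℕ i i<h) (fromℕ<-toℕ j j<w)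
  ... | no i≮h  | _       = contradiction (toℕ<n i) i≮h
  ... | yes _   | no j≮w  = contradiction (toℕ<n j) j≮w

  gridOf-bounded : ∀ r c → gridOf rows r c ≡ true → r < h × c < w
  gridOf-bounded r c pt with r <? h | c <? w
  ... | yes r<h | yes c<w = r<h , c<w

  tabulate-gridOf : tabulate (λ i → tabulate (λ j → gridOf rows (toℕ i) (toℕ j))) ≡ rows
  tabulate-gridOf = trans (tabulate-cong λ i → trans (tabulate-cong (gridOf-lookup i)) (tabulate∘lookup (lookup rows i)))
                          (tabulate∘lookup rows)

gridOf-tabulate : ∀ {h w} (f : Grid) → (∀ r c → f r c ≡ true → r < h × c < w) →
                  ∀ r c → gridOf {h} {w} (tabulate λ i → tabulate λ j → f (toℕ i) (toℕ j)) r c ≡ f r c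
gridOf-tabulate {h} {w} f bounded r c with r <? h | c <? w
... | yes r<h | yes c<w = trans (cong (λ row → lookup row (fromℕ< c<w)) (lookup∘tabulate _ (fromℕ< r<h)))
                                (trans (lookup∘tabulate _ (fromℕ< c<w))
                                       (cong₂ f (toℕ-fromℕ< r<h) (toℕ-fromℕ< c<w)))
... | no r≮h  | _       = sym (¬-not λ pt → r≮h (proj₁ (bounded r c pt)))
... | yes _   | no c≮w  = sym (¬-not λ pt → c≮w (proj₂ (bounded r c pt)))

module TableauGrid (t : RectTableau) where
  open GridNotions (gridOf (cells t))

  pointed⇒ : ∀ {i j} → Pointed t i j → Pt (toℕ i) (toℕ j)
  pointed⇒ {i} {j} = trans (gridOf-lookup (cells t) i j)

  pointed⇐ : ∀ {i j} → Pt (toℕ i) (toℕ j) → Pointed t i j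
  pointed⇐ {i} {j} = trans (sym (gridOf-lookup (cells t) i j))

  empty⇒ : ∀ {i j} → Empty t i j → gridOf (cells t) (toℕ i) (toℕ j) ≡ false
  empty⇒ {i} {j} = trans (gridOf-lookup (cells t) i j)

  empty⇐ : ∀ {i j} → gridOf (cells t) (toℕ i) (toℕ j) ≡ false → Empty t i j
  empty⇐ {i} {j} = trans (sym (gridOf-lookup (cells t) i j))

  rowOf : ∀ r c → Pt r c → Σ (Row t) λ i → toℕ i ≡ r
  rowOf r c pt = let r<h = proj₁ (gridOf-bounded (cells t) r c pt) in fromℕ< r<h , toℕ-fromℕ< r<h

  colOf : ∀ r c → Pt r c → Σ (Col t) λ j → toℕ j ≡ c
  colOf r c pt = let c<w = proj₂ (gridOf-bounded (cells t) r c pt) in fromℕ< c<w , toℕ-fromℕ< c<w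

  above⇒ : ∀ {i j} → PointAbove t i j → PtAbove (toℕ i) (toℕ j)
  above⇒ (k , k<i , pk) = toℕ k , k<i , pointed⇒ pk

  above⇐ : ∀ {i j} → PtAbove (toℕ i) (toℕ j) → PointAbove t i j
  above⇐ {j = j} (k , k<i , pk) with rowOf k (toℕ j) pk
  ... | k′ , refl = k′ , k<i , pointed⇐ pk

  left⇒ : ∀ {i j} → PointLeft t i j → PtLeft (toℕ i) (toℕ j)
  left⇒ (k , k<j , pk) = toℕ k , k<j , pointed⇒ pk

  left⇐ : ∀ {i j} → PtLeft (toℕ i) (toℕ j) → PointLeft t i j
  left⇐ {i} (k , k<j , pk) with colOf (toℕ i) k pk
  ... | k′ , refl = k′ , k<j , pointed⇐ pk

  leftChild⇒ : ∀ {i j i′} → LeftChild t i j i′ → LeftC (toℕ i) (toℕ j) (toℕ i′)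
  leftChild⇒ {i} {j} {i′} (pij , pi′j , i<i′ , gap , ¬left) =
    leftC (pointed⇒ pij) (pointed⇒ pi′j) i<i′ gap′ λ k k<j pk → ¬left (left⇐ (k , k<j , pk))
    where
    gap′ : ∀ k → toℕ i < k → k < toℕ i′ → ¬ Pt k (toℕ j)
    gap′ k i<k k<i′ pk with rowOf k (toℕ j) pk
    ... | k′ , refl = gap k′ i<k k<i′ (pointed⇐ pk)

  leftChild⇐ : ∀ {i j i′} → LeftC (toℕ i) (toℕ j) (toℕ i′) → LeftChild t i j i′
  leftChild⇐ (leftC pij pi′j i<i′ gap leftmost) =
    pointed⇐ pij , pointed⇐ pi′j , i<i′ , (λ k i<k k<i′ pk → gap (toℕ k) i<k k<i′ (pointed⇒ pk)) ,
    λ (k , k<j , pk) → leftmost (toℕ k) k<j (pointed⇒ pk)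

  rightChild⇒ : ∀ {i j j′} → RightChild t i j j′ → RightC (toℕ i) (toℕ j) (toℕ j′)
  rightChild⇒ {i} {j} {j′} (pij , pij′ , j<j′ , gap , ¬above) =
    rightC (pointed⇒ pij) (pointed⇒ pij′) j<j′ gap′ λ k k<i pk → ¬above (above⇐ (k , k<i , pk))
    where
    gap′ : ∀ k → toℕ j < k → k < toℕ j′ → ¬ Pt (toℕ i) k
    gap′ k j<k k<j′ pk with colOf (toℕ i) k pk
    ... | k′ , refl = gap k′ j<k k<j′ (pointed⇐ pk)

  rightChild⇐ : ∀ {i j j′} → RightC (toℕ i) (toℕ j) (toℕ j′) → RightChild t i j j′
  rightChild⇐ (rightC pij pij′ j<j′ gap topmost) =
    pointed⇐ pij , pointed⇐ pij′ , j<j′ , (λ k j<k k<j′ pk → gap (toℕ k) j<k k<j′ (pointed⇒ pk)) ,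
    λ (k , k<i , pk) → topmost (toℕ k) k<i (pointed⇒ pk)

  sub⇒ : ∀ {i j T} → Sub t i j T → GSub (toℕ i) (toℕ j) T
  leftSub⇒ : ∀ {i j T} → LeftSub t i j T → GLeftSub (toℕ i) (toℕ j) T
  rightSub⇒ : ∀ {i j T} → RightSub t i j T → GRightSub (toℕ i) (toℕ j) T

  sub⇒ (vertex pij sL sR) = gv (pointed⇒ pij) (leftSub⇒ sL) (rightSub⇒ sR)
  leftSub⇒ {j = j} (noLeft none) = noL λ i′ lc → let i″ , e = rowOf i′ (toℕ j) (LeftC.child lc) in
    none i″ (leftChild⇐ (subst (LeftC _ _) (sym e) lc))
  leftSub⇒ (hasLeft i′ lc s) = hasL (toℕ i′) (leftChild⇒ lc) (sub⇒ s)
  rightSub⇒ {i} (noRight none) = noR λ j′ rc → let j″ , e = colOf (toℕ i) j′ (RightC.child rc) in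
    none j″ (rightChild⇐ (subst (RightC _ _) (sym e) rc))
  rightSub⇒ (hasRight j′ rc s) = hasR (toℕ j′) (rightChild⇒ rc) (sub⇒ s)

  sub⇐ : ∀ {i j T} → GSub (toℕ i) (toℕ j) T → Sub t i j T
  leftSub⇐ : ∀ {i j T} → GLeftSub (toℕ i) (toℕ j) T → LeftSub t i j T
  rightSub⇐ : ∀ {i j T} → GRightSub (toℕ i) (toℕ j) T → RightSub t i j T

  sub⇐ (gv pij gl gr) = vertex (pointed⇐ pij) (leftSub⇐ gl) (rightSub⇐ gr)
  leftSub⇐ (noL none) = noLeft λ i′ lc → none (toℕ i′) (leftChild⇒ lc)
  leftSub⇐ {j = j} (hasL i′ lc s) with rowOf i′ (toℕ j) (LeftC.child lc)
  ... | i″ , refl = hasLeft i″ (leftChild⇐ lc) (sub⇐ s)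
  rightSub⇐ (noR none) = noRight λ j′ rc → none (toℕ j′) (rightChild⇒ rc)
  rightSub⇐ {i} (hasR j′ rc s) with colOf (toℕ i) j′ (RightC.child rc)
  ... | j″ , refl = hasRight j″ (rightChild⇐ rc) (sub⇐ s)

  isBaxterGrid⇒ : IsRectBaxterTLT t → IsBaxterGrid (suc (m t)) (suc (n t))
  isBaxterGrid⇒ ((_ , parentCond , rowPointed , colPointed) , ¬H , ¬V) = record
    { bounded    = gridOf-bounded (cells t)
    ; parentCond = parentCond′
    ; rowPointed = rowPointed′
    ; colPointed = colPointed′
    ; noH        = noH′
    ; noV        = noV′
    }
    where
    parentCond′ : ∀ r c → Pt r c → ¬ (r ≡ 0 × c ≡ 0) → ParentCondition r c
    parentCond′ r c pt ¬o with rowOf r c pt | colOf r c pt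
    ... | i , refl | j , refl
      with parentCond i j (pointed⇐ pt) (λ (i≡0 , j≡0) → ¬o (cong toℕ i≡0 , cong toℕ j≡0))
    ...   | inj₁ (above , ¬left) = inj₁ (above⇒ above , λ left → ¬left (left⇐ left))
    ...   | inj₂ (¬above , left) = inj₂ ((λ above → ¬above (above⇐ above)) , left⇒ left)
    rowPointed′ : ∀ r → r < suc (m t) → ∃[ c ] Pt r c
    rowPointed′ r r<h with rowPointed (fromℕ< r<h)
    ... | j , pt = toℕ j , subst (λ z → Pt z (toℕ j)) (toℕ-fromℕ< r<h) (pointed⇒ pt)
    colPointed′ : ∀ c → c < suc (n t) → ∃[ r ] Pt r c
    colPointed′ c c<w with colPointed (fromℕ< c<w)
    ... | i , pt = toℕ i , subst (Pt (toℕ i)) (toℕ-fromℕ< c<w) (pointed⇒ pt)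
    noH′ : ¬ HPattern
    noH′ (hPattern r₁ r₂ c₁ c₂ c₃ r₁<r₂ c₁<c₂ c₂<c₃ p₁ p₂ p₃ e₁ e₂)
      with rowOf r₁ c₂ p₁ | rowOf r₂ c₁ p₂ | colOf r₂ c₁ p₂ | colOf r₁ c₂ p₁ | colOf r₂ c₃ p₃
    ... | i₁ , refl | i₂ , refl | j₁ , refl | j₂ , refl | j₃ , refl =
      ¬H (i₁ , i₂ , j₁ , j₂ , j₃ , r₁<r₂ , c₁<c₂ , c₂<c₃ ,
          pointed⇐ p₁ , pointed⇐ p₂ , pointed⇐ p₃ , empty⇐ e₁ , empty⇐ e₂)
    noV′ : ¬ VPattern
    noV′ (vPattern r₁ r₂ r₃ c₁ c₂ r₁<r₂ r₂<r₃ c₁<c₂ p₁ p₂ p₃ e₁ e₂)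
      with rowOf r₁ c₂ p₁ | rowOf r₂ c₁ p₂ | rowOf r₃ c₂ p₃ | colOf r₂ c₁ p₂ | colOf r₁ c₂ p₁
    ... | i₁ , refl | i₂ , refl | i₃ , refl | j₁ , refl | j₂ , refl =
      ¬V (i₁ , i₂ , i₃ , j₁ , j₂ , r₁<r₂ , r₂<r₃ , c₁<c₂ ,
          pointed⇐ p₁ , pointed⇐ p₂ , pointed⇐ p₃ , empty⇐ e₁ , empty⇐ e₂)

  isBaxterGrid⇐ : IsBaxterGrid (suc (m t)) (suc (n t)) → Pt 0 0 → IsRectBaxterTLT t
  isBaxterGrid⇐ B p₀₀ = (pointed⇐ p₀₀ , parentCond′ , rowPointed′ , colPointed′) , ¬H , ¬V
    where
    open IsBaxterGrid B
    parentCond′ : ∀ i j → Pointed t i j → ¬ (i ≡ fzero × j ≡ fzero) →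
                  (PointAbove t i j × ¬ PointLeft t i j) ⊎ (¬ PointAbove t i j × PointLeft t i j)
    parentCond′ i j p ¬o with parentCond (toℕ i) (toℕ j) (pointed⇒ p)
                                (λ (i≡0 , j≡0) → ¬o (toℕ-injective i≡0 , toℕ-injective j≡0))
    ... | inj₁ (above , ¬left) = inj₁ (above⇐ above , λ left → ¬left (left⇒ left))
    ... | inj₂ (¬above , left) = inj₂ ((λ above → ¬above (above⇒ above)) , left⇐ left)
    rowPointed′ : ∀ i → ∃[ j ] Pointed t i j
    rowPointed′ i with rowPointed (toℕ i) (toℕ<n i)
    ... | c , pt with colOf (toℕ i) c pt
    ...   | j , refl = j , pointed⇐ pt
    colPointed′ : ∀ j → ∃[ i ] Pointed t i j
    colPointed′ j with colPointed (toℕ j) (toℕ<n j)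
    ... | r , pt with rowOf r (toℕ j) pt
    ...   | i , refl = i , pointed⇐ pt
    ¬H : ¬ ContainsH t
    ¬H (r₁ , r₂ , c₁ , c₂ , c₃ , r₁<r₂ , c₁<c₂ , c₂<c₃ , p₁ , p₂ , p₃ , e₁ , e₂) =
      noH (hPattern (toℕ r₁) (toℕ r₂) (toℕ c₁) (toℕ c₂) (toℕ c₃) r₁<r₂ c₁<c₂ c₂<c₃
                    (pointed⇒ p₁) (pointed⇒ p₂) (pointed⇒ p₃) (empty⇒ e₁) (empty⇒ e₂))
    ¬V : ¬ ContainsV t
    ¬V (r₁ , r₂ , r₃ , c₁ , c₂ , r₁<r₂ , r₂<r₃ , c₁<c₂ , p₁ , p₂ , p₃ , e₁ , e₂) =
      noV (vPattern (toℕ r₁) (toℕ r₂) (toℕ r₃) (toℕ c₁) (toℕ c₂) r₁<r₂ r₂<r₃ c₁<c₂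
                    (pointed⇒ p₁) (pointed⇒ p₂) (pointed⇒ p₃) (empty⇒ e₁) (empty⇒ e₂))

module _ {g g′ : Grid} (g≗g′ : ∀ r c → g r c ≡ g′ r c) {H W : ℕ} where
  private
    module G  = GridNotions g
    module G′ = GridNotions g′

  isBaxterGrid-resp : G.IsBaxterGrid H W → G′.IsBaxterGrid H W
  isBaxterGrid-resp B = record
    { bounded    = λ r c pt → bounded r c (⇐ pt)
    ; parentCond = parentCond′
    ; rowPointed = λ r r<H → let c , pt = rowPointed r r<H in c , ⇒ pt
    ; colPointed = λ c c<W → let r , pt = colPointed c c<W in r , ⇒ pt
    ; noH = λ { (G′.hPattern r₁ r₂ c₁ c₂ c₃ a b d p₁ p₂ p₃ e₁ e₂) →
                noH (G.hPattern r₁ r₂ c₁ c₂ c₃ a b d (⇐ p₁) (⇐ p₂) (⇐ p₃) (⇐ e₁) (⇐ e₂)) }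
    ; noV = λ { (G′.vPattern r₁ r₂ r₃ c₁ c₂ a b d p₁ p₂ p₃ e₁ e₂) →
                noV (G.vPattern r₁ r₂ r₃ c₁ c₂ a b d (⇐ p₁) (⇐ p₂) (⇐ p₃) (⇐ e₁) (⇐ e₂)) }
    }
    where
    open G.IsBaxterGrid B
    ⇐ : ∀ {r c b} → g′ r c ≡ b → g r c ≡ b
    ⇐ {r} {c} = trans (g≗g′ r c)
    ⇒ : ∀ {r c b} → g r c ≡ b → g′ r c ≡ b
    ⇒ {r} {c} = trans (sym (g≗g′ r c))
    parentCond′ : ∀ r c → G′.Pt r c → ¬ (r ≡ 0 × c ≡ 0) → G′.ParentCondition r c
    parentCond′ r c pt ¬o with parentCond r c (⇐ pt) ¬o
    ... | inj₁ ((k , k<r , pk) , ¬left) = inj₁ ((k , k<r , ⇒ pk) , λ (k , k<c , pk) → ¬left (k , k<c , ⇐ pk))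
    ... | inj₂ (¬above , (k , k<c , pk)) = inj₂ ((λ (k , k<r , pk) → ¬above (k , k<r , ⇐ pk)) , (k , k<c , ⇒ pk))

module _ {g : Grid} where
  open GridNotions g

  isBaxterGrid-dimensions : ∀ {H W H′ W′} → IsBaxterGrid H W → IsBaxterGrid H′ W′ → H ≡ H′ × W ≡ W′
  isBaxterGrid-dimensions B B′ =
    ≤-antisym (height≤ B B′) (height≤ B′ B) , ≤-antisym (width≤ B B′) (width≤ B′ B)
    where
    height≤ : ∀ {H W H′ W′} → IsBaxterGrid H W → IsBaxterGrid H′ W′ → H ≤ H′
    height≤ {H′ = H′} B B′ = ≮⇒≥ λ H′<H →
      let c , pt = IsBaxterGrid.rowPointed B H′ H′<H in <-irrefl refl (proj₁ (IsBaxterGrid.bounded B′ H′ c pt))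
    width≤ : ∀ {H W H′ W′} → IsBaxterGrid H W → IsBaxterGrid H′ W′ → W ≤ W′
    width≤ {W′ = W′} B B′ = ≮⇒≥ λ W′<W →
      let r , pt = IsBaxterGrid.colPointed B W′ W′<W in <-irrefl refl (proj₂ (IsBaxterGrid.bounded B′ r W′ pt))

<⇒<suc-pred : ∀ {m n} → m < n → m < suc (pred n)
<⇒<suc-pred {n = suc n} m<n = m<n

canonTableau : BT → RectTableau
canonTableau T = mkTab (pred (height T)) (pred (width T)) (tabulate λ i → tabulate λ j → canon T (toℕ i) (toℕ j))

gridOf-canonTableau : ∀ T r c → gridOf (cells (canonTableau T)) r c ≡ canon T r c
gridOf-canonTableau T = gridOf-tabulate (canon T) λ r c pt →
  let r<h , c<w = canon-bounded T r c pt in <⇒<suc-pred r<h , <⇒<suc-pred c<w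

canonTableau-isBaxter : ∀ L R → IsRectBaxterTLT (canonTableau (node L R))
canonTableau-isBaxter L R =
  TableauGrid.isBaxterGrid⇐ t
    (subst₂ (GridNotions.IsBaxterGrid (gridOf (cells t)))
            (sym (suc-pred-pos (height⁺-pos T))) (sym (suc-pred-pos (width⁺-pos T)))
       (isBaxterGrid-resp (λ r c → sym (gridOf-canonTableau T r c)) (canon-isBaxter T)))
    (trans (gridOf-canonTableau T 0 0) (canon-origin L R))
  where
  T : BT
  T = node L R
  t : RectTableau
  t = canonTableau T
  suc-pred-pos : ∀ {n} → 1 ≤ n → suc (pred n) ≡ n
  suc-pred-pos {suc n} _ = refl

canonTableau-underlying : ∀ L R → UnderlyingTree (canonTableau (node L R)) (node L R)
canonTableau-underlying L R =
  TableauGrid.sub⇐ (canonTableau T)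
    (Existence.placed-sub _ T (λ ()) record
      { agrees     = gridOf-canonTableau T
      ; westClear  = λ _ _ _ _ ()
      ; northClear = λ _ _ _ _ ()
      })
  where
  T : BT
  T = node L R

canonTableau-≡ : ∀ T {m n} (cs : Vec (Vec Bool (suc n)) (suc m)) → pred (height T) ≡ m → pred (width T) ≡ n →
                 (∀ r c → gridOf cs r c ≡ canon T r c) → canonTableau T ≡ mkTab m n cs
canonTableau-≡ T cs refl refl agree =
  cong (mkTab _ _) (trans (tabulate-cong λ i → tabulate-cong λ j → sym (agree (toℕ i) (toℕ j))) (tabulate-gridOf cs))

canonTableau-unique : ∀ T t → IsRectBaxterTLT t → UnderlyingTree t T → canonTableau T ≡ t
canonTableau-unique T t@(mkTab m n cs) bax sub =
  canonTableau-≡ T cs (cong pred h≡) (cong pred w≡) agree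
  where
  B : GridNotions.IsBaxterGrid (gridOf cs) (suc m) (suc n)
  B = TableauGrid.isBaxterGrid⇒ t bax
  agree : ∀ r c → gridOf cs r c ≡ canon T r c
  agree = Uniqueness.sub-agrees (gridOf cs) B (TableauGrid.sub⇒ t sub)
  dims : height T ≡ suc m × width T ≡ suc n
  dims = isBaxterGrid-dimensions (isBaxterGrid-resp (λ r c → sym (agree r c)) (canon-isBaxter T)) B
  h≡ : height T ≡ suc m
  h≡ = proj₁ dims
  w≡ : width T ≡ suc n
  w≡ = proj₂ dims

corollary2p9 : (T : BT) → T ≢ leaf →
    ∃! _≡_ (λ (t : RectTableau) → IsRectBaxterTLT t × UnderlyingTree t T)
corollary2p9 leaf       leaf≢leaf = contradiction refl leaf≢leaf
corollary2p9 (node L R) _         =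
  canonTableau (node L R) , (canonTableau-isBaxter L R , canonTableau-underlying L R) ,
  λ (bax , sub) → canonTableau-unique (node L R) _ bax sub
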